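{- Let $n\ge1$ and $D\subseteq[n-1]$. Then $$\tilde Q_{n,D}(X,Y)=\sum_{i=0}^{n}F_{i,D_1}(X)\,F_{n-i,D_2}(Y),$$ where for each $i$ the sets $D_1\subseteq[i-1]$ and $D_2\subseteq[n-i-1]$ are the ones determined by: $\boldsymbol{\beta}(D_1)\cdot\boldsymbol{\beta}(\overline{D_2})=\boldsymbol{\beta}(D)$ if $i\in D$, and $\boldsymbol{\beta}(D_1)\odot\boldsymbol{\beta}(\overline{D_2})=\boldsymbol{\beta}(D)$ if $i\notin D$; here $\overline{D_2}=[n-i-1]\setminus D_2$.
   Context: Fix $k,l\ge0$, $\mathcal{A}=\{1,\dots,k\}$, $\mathcal{A}'=\{1',\dots,l'\}$ with total order $1<\dots<k<1'<\dots<l'$, $X=(x_1,\dots,x_k)$, $Y=(y_1,\dots,y_l)$, and set $z_a=x_a$ for $a\in\mathcal{A}$, $z_{a'}=y_a$ for $a'\in\mathcal{A}'$. $[p]=\{1,\dots,p\}$ (empty if $p\le 0$). Fundamental quasisymmetric function: for $D\subseteq[n-1]$ and a totally ordered variable set $W=(w_1,w_2,\dots)$, $F_{n,D}(W)=\sum w_{a_1}\cdots w_{a_n}$ over $a_1\le\dots\le a_n$ with $a_i=a_{i+1}\Rightarrow i\notin D$; $F_{0,\emptyset}=1$. Super fundamental quasisymmetric function: $\tilde Q_{n,D}(X,Y)=\sum z_{a_1}\cdots z_{a_n}$ over sequences $a_1\le a_2\le\dots\le a_n$ in $\mathcal{A}\cup\mathcal{A}'$ such that $a_i=a_{i+1}\in\mathcal{A}\Rightarrow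 i\notin D$ and $a_i=a_{i+1}\in\mathcal{A}'\Rightarrow i\in D$. For $S=\{s_1<\dots<s_p\}\subseteq[N-1]$, $\boldsymbol\beta(S)=(s_1,s_2-s_1,\dots,s_p-s_{p-1},N-s_p)$, a composition of $N$ (with $\boldsymbol\beta(\emptyset)=(N)$ for $N\ge 1$ and the empty composition for $N=0$). Concatenation: $(\alpha_1,\dots,\alpha_p)\cdot(\gamma_1,\dots,\gamma_q)=(\alpha_1,\dots,\alpha_p,\gamma_1,\dots,\gamma_q)$; almost concatenation: $(\alpha_1,\dots,\alpha_p)\odot(\gamma_1,\dots,\gamma_q)=(\alpha_1,\dots,\alpha_{p-1},\alpha_p+\gamma_1,\gamma_2,\dots,\gamma_q)$, with the convention that concatenating or almost concatenating with the empty composition leaves the other composition unchanged. -}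

module Defs where

open import Level using (Level)
open import Data.Nat using (ℕ; zero; suc; _+_; _∸_; _≤_; _<ᵇ_; _≤ᵇ_; _≡ᵇ_)
open import Data.Bool using (Bool; true; false; _∧_; _∨_; not; if_then_else_)
open import Data.List using (List; []; _∷_; _++_; map; concatMap; filterᵇ; upTo; foldr)
open import Data.Product using (_×_)
open import Relation.Binary.PropositionalEquality using (_≡_)
open import Algebra.Bundles using (CommutativeSemiring)

-- Subsets of ℕ are represented by Bool-valued characteristic functions.
-- [p] = {1,…,p} (empty if p ≤ 0); membership test.
inRange : ℕ → ℕ → Bool
inRange p j = (1 ≤ᵇ j) ∧ (j ≤ᵇ p)

_⊆[_] : (ℕ → Bool) → ℕ → Set
S ⊆[ p ] = ∀ j → S j ≡ true → (1 ≤ j) × (j ≤ p)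

compl : ℕ → (ℕ → Bool) → ℕ → Bool
compl p S j = inRange p j ∧ not (S j)

range1 : ℕ → List ℕ
range1 p = map suc (upTo p)

diffs : ℕ → List ℕ → ℕ → List ℕ
diffs prev []       N = (N ∸ prev) ∷ []
diffs prev (s ∷ ss) N = (s ∸ prev) ∷ diffs s ss N

-- β(S) for S ⊆ [N-1], a composition of N
β : ℕ → (ℕ → Bool) → List ℕ
β zero    S = []
β (suc m) S = diffs 0 (filterᵇ S (range1 m)) (suc m)

_⊙_ : List ℕ → List ℕ → List ℕ
[]            ⊙ γ        = γ
(a ∷ [])      ⊙ []       = a ∷ []
(a ∷ [])      ⊙ (g ∷ gs) = (a + g) ∷ gs
(a ∷ b ∷ as)  ⊙ γ        = a ∷ ((b ∷ as) ⊙ γ)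

words : ℕ → ℕ → List (List ℕ)
words zero    m = [] ∷ []
words (suc n) m = concatMap (λ a → map (a ∷_) (words n m)) (upTo m)

incr : List ℕ → Bool
incr (a ∷ b ∷ rest) = (a ≤ᵇ b) ∧ incr (b ∷ rest)
incr _ = true

-- condition for F_{n,D}: a_i = a_{i+1} ⇒ i ∉ D (positions 1-indexed)
validF : (ℕ → Bool) → ℕ → List ℕ → Bool
validF D i (a ∷ b ∷ rest) = (not (a ≡ᵇ b) ∨ not (D i)) ∧ validF D (suc i) (b ∷ rest)
validF D i _ = true

-- condition for Q̃_{n,D}: letters < k are unprimed (𝒜), letters ≥ k are primed (𝒜')
-- a_i = a_{i+1} ∈ 𝒜 ⇒ i ∉ D ;  a_i = a_{i+1} ∈ 𝒜' ⇒ i ∈ D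
validQ : ℕ → (ℕ → Bool) → ℕ → List ℕ → Bool
validQ k D i (a ∷ b ∷ rest) =
  (if a ≡ᵇ b then (if a <ᵇ k then not (D i) else D i) else true)
  ∧ validQ k D (suc i) (b ∷ rest)
validQ k D i _ = true

Split : ℕ → (ℕ → Bool) → ℕ → (ℕ → Bool) → (ℕ → Bool) → Set
Split n D i D1 D2 =
  (D1 ⊆[ i ∸ 1 ]) × (D2 ⊆[ n ∸ i ∸ 1 ])
  × (D i ≡ true  → β i D1 ++ β (n ∸ i) (compl (n ∸ i ∸ 1) D2) ≡ β n D)
  × (D i ≡ false → β i D1 ⊙ β (n ∸ i) (compl (n ∸ i ∸ 1) D2) ≡ β n D)

module Eval {c ℓ : Level} (R : CommutativeSemiring c ℓ) where
  open CommutativeSemiring R renaming (_+_ to _+R_)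

  sumR : List Carrier → Carrier
  sumR = foldr _+R_ 0#

  prodR : List Carrier → Carrier
  prodR = foldr _*_ 1#

  -- F_{n,D}(w_0, …, w_{m-1})  (variables indexed from 0)
  F : ℕ → (ℕ → Bool) → ℕ → (ℕ → Carrier) → Carrier
  F n D m w = sumR (map (λ s → prodR (map w s))
                        (filterᵇ (λ s → incr s ∧ validF D 1 s) (words n m)))

  z : ℕ → (ℕ → Carrier) → (ℕ → Carrier) → ℕ → Carrier
  z k x y a = if a <ᵇ k then x a else y (a ∸ k)

  Q : ℕ → (ℕ → Bool) → ℕ → ℕ → (ℕ → Carrier) → (ℕ → Carrier) → Carrier
  Q n D k l x y = sumR (map (λ s → prodR (map (z k x y) s))
                        (filterᵇ (λ s → incr s ∧ validQ k D 1 s) (words n (k + l))))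

module Submission where

-- An admissible word for Q̃_{n,D} is weakly increasing, so it is a word u in unprimed letters followed by a
-- word v in primed letters. If |u| = i, the conditions on u are exactly those of F_{i,D}(X), the conditions on v
-- are those of F_{n-i,D'}(Y) with D' = {t : i + t ∉ D}, and the monomial factorises; hence
-- Q̃_{n,D} = Σ_i F_{i,D}(X) F_{n-i,D'}(Y). On the other side, β(D) is β(D ∩ [i-1]) glued with β of the shifted D
-- by concatenation if i ∈ D and by almost concatenation otherwise, and this gluing is injective. So the D₁, D₂ of
-- the statement exist and agree with D and D' on [i-1] and [n-i-1], the only positions F_{i,·} and F_{n-i,·} see.

open import Defs
open import Level using (Level)
open import Data.Nat using (ℕ; zero; suc; _+_; _∸_; _≤_; _<_; _≤ᵇ_; _<ᵇ_; _≡ᵇ_; z<s; s<s; s≤s⁻¹; pred)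
open import Data.Nat.Properties
  using ( +-comm; +-suc; +-identityʳ; m+n∸m≡n; m+[n∸m]≡n; m≤m+n; m+n≮m; 1+n≰n; n≤1+n; ≤-refl; ≤-trans
        ; <-≤-trans; <⇒≤; <⇒≱; <⇒≢; ≤ᵇ⇒≤; ≤⇒≤ᵇ; ≤ᵇ-reflects-≤; <ᵇ-reflects-<; ≡ᵇ⇒≡; ≡⇒≡ᵇ)
open import Data.Bool using (Bool; true; false; _∧_; _∨_; not; if_then_else_)
open import Data.Bool.Properties
  using (T-≡; ∧-assoc; ∧-zeroʳ; ∧-conicalˡ; ∧-conicalʳ; ∧-commutativeMonoid; not-involutive)
open import Data.List using (List; []; _∷_; _++_; map; length; filterᵇ; applyUpTo; upTo; concatMap)
open import Data.List.Properties
  using (∷-injective; ∷-injectiveˡ; ∷-injectiveʳ; ++-identityʳ; map-++; map-∘; map-upTo)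
open import Data.List.Relation.Unary.All using (All; []; _∷_)
open import Data.Product using (Σ-syntax; _×_; _,_)
open import Data.Empty using (⊥-elim)
open import Function using (_∘_; _∘₂_; Equivalence)
open import Relation.Nullary.Reflects using (ofʸ; ofⁿ; det; fromEquivalence)
open import Relation.Binary.PropositionalEquality
  using (_≡_; _≢_; refl; sym; trans; cong; cong₂; module ≡-Reasoning)
open import Algebra.Bundles using (CommutativeSemiring; CommutativeMonoid)
import Algebra.Properties.CommutativeSemigroup as CommutativeSemigroupProperties

open CommutativeSemigroupProperties (CommutativeMonoid.commutativeSemigroup ∧-commutativeMonoid)
  using () renaming (interchange to ∧-interchange)

infix 4 _≗[_]_

_≗[_]_ : (ℕ → Bool) → ℕ → (ℕ → Bool) → Set
S ≗[ r ] T = ∀ t → t < r → S (suc t) ≡ T (suc t)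

bits : ℕ → (ℕ → Bool) → List Bool
bits zero    S = []
bits (suc r) S = S 1 ∷ bits r (S ∘ suc)

length-bits : ∀ r S → length (bits r S) ≡ r
length-bits zero    S = refl
length-bits (suc r) S = cong suc (length-bits r (S ∘ suc))

bits-cong : ∀ r {S T} → S ≗[ r ] T → bits r S ≡ bits r T
bits-cong zero    S≗T = refl
bits-cong (suc r) S≗T = cong₂ _∷_ (S≗T 0 z<s) (bits-cong r (λ t t<r → S≗T (suc t) (s<s t<r)))

bits-injective : ∀ r {S T} → bits r S ≡ bits r T → S ≗[ r ] T
bits-injective (suc r) eq zero    _       = ∷-injectiveˡ eq
bits-injective (suc r) eq (suc t) (s<s t<r) = bits-injective r (∷-injectiveʳ eq) t t<r

bits-split : ∀ a b S → bits (a + suc b) S ≡ bits a S ++ S (suc a) ∷ bits b (λ t → S (suc a + t))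
bits-split zero    b S = refl
bits-split (suc a) b S = cong (S 1 ∷_) (bits-split a b (S ∘ suc))

++-injective : ∀ {A : Set} (xs ys : List A) {zs ws} →
  length xs ≡ length ys → xs ++ zs ≡ ys ++ ws → xs ≡ ys × zs ≡ ws
++-injective []       []       _   eq = refl , eq
++-injective (x ∷ xs) (y ∷ ys) len eq =
  let x≡y , rest = ∷-injective eq
      xs≡ys , zs≡ws = ++-injective xs ys (cong pred len) rest
  in cong₂ _∷_ x≡y xs≡ys , zs≡ws

-- The composition cut after each position holding true, whose first part already has c elements.
composition : ℕ → List Bool → List ℕ
composition c []           = c ∷ []
composition c (true  ∷ bs) = c ∷ composition 1 bs
composition c (false ∷ bs) = composition (suc c) bs

composition-≢[] : ∀ c bs → composition c bs ≢ []
composition-≢[] c (true  ∷ bs) ()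
composition-≢[] c (false ∷ bs) eq = composition-≢[] (suc c) bs eq

composition-head≥ : ∀ c bs {y ys} → composition c bs ≡ y ∷ ys → c ≤ y
composition-head≥ c []           refl = ≤-refl
composition-head≥ c (true  ∷ bs) refl = ≤-refl
composition-head≥ c (false ∷ bs) eq   = ≤-trans (n≤1+n c) (composition-head≥ (suc c) bs eq)

composition-suc≢ : ∀ c bs {ys} → composition (suc c) bs ≢ c ∷ ys
composition-suc≢ c bs eq = 1+n≰n (composition-head≥ (suc c) bs eq)

composition-injective : ∀ c bs bs′ → composition c bs ≡ composition c bs′ → bs ≡ bs′
composition-injective c []           []            eq = refl
composition-injective c []           (true  ∷ bs′) eq = ⊥-elim (composition-≢[] 1 bs′ (sym (∷-injectiveʳ eq)))
composition-injective c []           (false ∷ bs′) eq = ⊥-elim (composition-suc≢ c bs′ (sym eq))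
composition-injective c (true  ∷ bs) []            eq = ⊥-elim (composition-≢[] 1 bs (∷-injectiveʳ eq))
composition-injective c (true  ∷ bs) (true  ∷ bs′) eq =
  cong (true ∷_) (composition-injective 1 bs bs′ (∷-injectiveʳ eq))
composition-injective c (true  ∷ bs) (false ∷ bs′) eq = ⊥-elim (composition-suc≢ c bs′ (sym eq))
composition-injective c (false ∷ bs) []            eq = ⊥-elim (composition-suc≢ c bs eq)
composition-injective c (false ∷ bs) (true  ∷ bs′) eq = ⊥-elim (composition-suc≢ c bs eq)
composition-injective c (false ∷ bs) (false ∷ bs′) eq =
  cong (false ∷_) (composition-injective (suc c) bs bs′ eq)

glue : Bool → List ℕ → List ℕ → List ℕ
glue true  = _++_
glue false = _⊙_

⊙-identityʳ : ∀ α → α ⊙ [] ≡ α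
⊙-identityʳ []          = refl
⊙-identityʳ (a ∷ [])    = refl
⊙-identityʳ (a ∷ b ∷ α) = cong (a ∷_) (⊙-identityʳ (b ∷ α))

glue-identityˡ : ∀ b γ → glue b [] γ ≡ γ
glue-identityˡ true  γ = refl
glue-identityˡ false γ = refl

glue-identityʳ : ∀ b α → glue b α [] ≡ α
glue-identityʳ true  α = ++-identityʳ α
glue-identityʳ false α = ⊙-identityʳ α

glue-∷ : ∀ b a α γ → α ≢ [] → glue b (a ∷ α) γ ≡ a ∷ glue b α γ
glue-∷ true  a α       γ _   = refl
glue-∷ false a []      γ α≢[] = ⊥-elim (α≢[] refl)
glue-∷ false a (_ ∷ _) γ _   = refl

composition-⊙ : ∀ a c bs → composition (a + c) bs ≡ (a ∷ []) ⊙ composition c bs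
composition-⊙ a c []           = refl
composition-⊙ a c (true  ∷ bs) = refl
composition-⊙ a c (false ∷ bs) = trans (cong (λ d → composition d bs) (sym (+-suc a c))) (composition-⊙ a (suc c) bs)

composition-glue : ∀ c bs b cs → composition c (bs ++ b ∷ cs) ≡ glue b (composition c bs) (composition 1 cs)
composition-glue c []           true  cs = refl
composition-glue c []           false cs =
  trans (cong (λ d → composition d cs) (+-comm 1 c)) (composition-⊙ c 1 cs)
composition-glue c (true  ∷ bs) b     cs =
  trans (cong (c ∷_) (composition-glue 1 bs b cs)) (sym (glue-∷ b c _ _ (composition-≢[] 1 bs)))
composition-glue c (false ∷ bs) b     cs = composition-glue (suc c) bs b cs

-- The running part size c is the distance from the last cut p to the next position f 0.
diffs-filterᵇ : ∀ S r (f : ℕ → ℕ) p c → f 0 ≡ p + c → (∀ t → f (suc t) ≡ suc (f t)) →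
  diffs p (filterᵇ S (applyUpTo f r)) (f r) ≡ composition c (bits r (S ∘ f ∘ pred))
diffs-filterᵇ S zero    f p c f0 f-suc = cong (_∷ []) (trans (cong (_∸ p) f0) (m+n∸m≡n p c))
diffs-filterᵇ S (suc r) f p c f0 f-suc with S (f 0)
... | true  = cong₂ _∷_ (trans (cong (_∸ p) f0) (m+n∸m≡n p c))
                (trans (diffs-filterᵇ S r (f ∘ suc) (f 0) 1 (trans (f-suc 0) (+-comm 1 (f 0))) (f-suc ∘ suc))
                       (cong (composition 1) (bits-cong r (λ _ _ → refl))))
... | false = trans (diffs-filterᵇ S r (f ∘ suc) p (suc c) (trans (f-suc 0) (trans (cong suc f0) (sym (+-suc p c))))
                                   (f-suc ∘ suc))
                    (cong (composition (suc c)) (bits-cong r (λ _ _ → refl)))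

β-bits : ∀ m S → β (suc m) S ≡ composition 1 (bits m S)
β-bits m S = begin
  diffs 0 (filterᵇ S (map suc (upTo m))) (suc m) ≡⟨ cong (λ xs → diffs 0 (filterᵇ S xs) (suc m)) (map-upTo suc m) ⟩
  diffs 0 (filterᵇ S (applyUpTo suc m)) (suc m)  ≡⟨ diffs-filterᵇ S m suc 0 1 refl (λ _ → refl) ⟩
  composition 1 (bits m (S ∘ suc ∘ pred))         ≡⟨ cong (composition 1) (bits-cong m (λ _ _ → refl)) ⟩
  composition 1 (bits m S)                         ∎
  where open ≡-Reasoning

β-cong : ∀ N {S T} → S ≗[ N ∸ 1 ] T → β N S ≡ β N T
β-cong zero    _   = refl
β-cong (suc m) S≗T = trans (β-bits m _) (trans (cong (composition 1) (bits-cong m S≗T)) (sym (β-bits m _)))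

β-injective : ∀ N {S T} → β N S ≡ β N T → S ≗[ N ∸ 1 ] T
β-injective zero    _  _ ()
β-injective (suc m) eq =
  bits-injective m (composition-injective 1 _ _ (trans (sym (β-bits m _)) (trans eq (β-bits m _))))

β-glue : ∀ i j U → β (i + j) U ≡ glue (U i) (β i U) (β j (λ t → U (i + t)))
β-glue zero    j       U = sym (glue-identityˡ (U 0) (β j U))
β-glue (suc a) zero    U = trans (cong (λ N → β N U) (+-identityʳ (suc a))) (sym (glue-identityʳ (U (suc a)) _))
β-glue (suc a) (suc b) U = begin
  β (suc (a + suc b)) U
    ≡⟨ β-bits (a + suc b) U ⟩
  composition 1 (bits (a + suc b) U)
    ≡⟨ cong (composition 1) (bits-split a b U) ⟩
  composition 1 (bits a U ++ U (suc a) ∷ bits b U′)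
    ≡⟨ composition-glue 1 (bits a U) (U (suc a)) (bits b U′) ⟩
  glue (U (suc a)) (composition 1 (bits a U)) (composition 1 (bits b U′))
    ≡⟨ cong₂ (glue (U (suc a))) (β-bits a U) (β-bits b U′) ⟨
  glue (U (suc a)) (β (suc a) U) (β (suc b) U′) ∎
  where
  open ≡-Reasoning
  U′ = λ t → U (suc a + t)

glue-β-injective : ∀ b i j {S S′ T T′} → glue b (β i S) (β j T) ≡ glue b (β i S′) (β j T′) →
  S ≗[ i ∸ 1 ] S′ × T ≗[ j ∸ 1 ] T′
glue-β-injective b zero j eq =
  (λ _ ()) , β-injective j (trans (sym (glue-identityˡ b _)) (trans eq (glue-identityˡ b _)))
glue-β-injective b (suc a) zero eq =
  β-injective (suc a) (trans (sym (glue-identityʳ b _)) (trans eq (glue-identityʳ b _))) , (λ _ ())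
glue-β-injective b (suc a) (suc c) {S} {S′} {T} {T′} eq =
  let bitsS≡bitsS′ , bT≡bT′ = ++-injective (bits a S) (bits a S′) (trans (length-bits a S) (sym (length-bits a S′)))
                                (composition-injective 1 _ _ (trans (sym (glue-bits S T)) (trans eq (glue-bits S′ T′))))
  in bits-injective a bitsS≡bitsS′ , bits-injective c (∷-injectiveʳ bT≡bT′)
  where
  glue-bits : ∀ S T → glue b (β (suc a) S) (β (suc c) T) ≡ composition 1 (bits a S ++ b ∷ bits c T)
  glue-bits S T = trans (cong₂ (glue b) (β-bits a S) (β-bits c T)) (sym (composition-glue 1 (bits a S) b (bits c T)))

restrict : ℕ → (ℕ → Bool) → ℕ → Bool
restrict p S t = inRange p t ∧ S t

inRange-suc : ∀ {p t} → t < p → inRange p (suc t) ≡ true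
inRange-suc t<p = Equivalence.to T-≡ (≤⇒≤ᵇ t<p)

restrict-⊆ : ∀ p S → restrict p S ⊆[ p ]
restrict-⊆ p S t eq = let t∈[p] = ∧-conicalˡ _ _ eq in
  ≤ᵇ⇒≤ 1 t (Equivalence.from T-≡ (∧-conicalˡ _ _ t∈[p])) , ≤ᵇ⇒≤ t p (Equivalence.from T-≡ (∧-conicalʳ _ _ t∈[p]))

restrict-≗ : ∀ p S → restrict p S ≗[ p ] S
restrict-≗ p S t t<p rewrite inRange-suc t<p = refl

D₁ : (ℕ → Bool) → ℕ → ℕ → Bool
D₁ D i = restrict (i ∸ 1) D

D₂ : ℕ → (ℕ → Bool) → ℕ → ℕ → Bool
D₂ n D i = restrict (n ∸ i ∸ 1) (λ t → not (D (i + t)))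

glue⇒cases : ∀ b {α γ δ} → glue b α γ ≡ δ → (b ≡ true → α ++ γ ≡ δ) × (b ≡ false → α ⊙ γ ≡ δ)
glue⇒cases true  eq = (λ _ → eq) , (λ ())
glue⇒cases false eq = (λ ()) , (λ _ → eq)

cases⇒glue : ∀ b {α γ δ} → (b ≡ true → α ++ γ ≡ δ) → (b ≡ false → α ⊙ γ ≡ δ) → glue b α γ ≡ δ
cases⇒glue true  ++-case _      = ++-case refl
cases⇒glue false _       ⊙-case = ⊙-case refl

β-glue-≤ : ∀ {n i} D → i ≤ n → glue (D i) (β i D) (β (n ∸ i) (λ t → D (i + t))) ≡ β n D
β-glue-≤ {n} {i} D i≤n = trans (sym (β-glue i (n ∸ i) D)) (cong (λ N → β N D) (m+[n∸m]≡n i≤n))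

Split-D₁-D₂ : ∀ n D i → i ≤ n → Split n D i (D₁ D i) (D₂ n D i)
Split-D₁-D₂ n D i i≤n = restrict-⊆ (i ∸ 1) D , restrict-⊆ (n ∸ i ∸ 1) _ , glue⇒cases (D i) (begin
  glue (D i) (β i (D₁ D i)) (β (n ∸ i) (compl (n ∸ i ∸ 1) (D₂ n D i)))
    ≡⟨ cong₂ (glue (D i)) (β-cong i (restrict-≗ (i ∸ 1) D)) (β-cong (n ∸ i) compl-D₂≗D) ⟩
  glue (D i) (β i D) (β (n ∸ i) (λ t → D (i + t)))
    ≡⟨ β-glue-≤ D i≤n ⟩
  β n D ∎)
  where
  open ≡-Reasoning
  compl-D₂≗D : compl (n ∸ i ∸ 1) (D₂ n D i) ≗[ n ∸ i ∸ 1 ] (λ t → D (i + t))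
  compl-D₂≗D t t<p rewrite inRange-suc t<p = not-involutive (D (i + suc t))

Split-unique : ∀ n D i {E₁ E₂} → i ≤ n → Split n D i E₁ E₂ →
  E₁ ≗[ i ∸ 1 ] D × E₂ ≗[ n ∸ i ∸ 1 ] (λ t → not (D (i + t)))
Split-unique n D i {E₁} {E₂} i≤n (_ , _ , ++-case , ⊙-case) =
  let E₁≗D , compl-E₂≗D = glue-β-injective (D i) i (n ∸ i)
                             (trans (cases⇒glue (D i) ++-case ⊙-case) (sym (β-glue-≤ D i≤n)))
  in E₁≗D , λ t t<p → trans (sym (not-involutive _))
                             (cong not (trans (sym (restrict-≗ _ (not ∘ E₂) t t<p)) (compl-E₂≗D t t<p)))

≤ᵇ-false : ∀ {a b} → b < a → (a ≤ᵇ b) ≡ false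
≤ᵇ-false {a} {b} b<a = det (≤ᵇ-reflects-≤ a b) (ofⁿ (<⇒≱ b<a))

<ᵇ-true : ∀ {a k} → a < k → (a <ᵇ k) ≡ true
<ᵇ-true {a} {k} a<k = det (<ᵇ-reflects-< a k) (ofʸ a<k)

+-<ᵇ-false : ∀ k b → (k + b <ᵇ k) ≡ false
+-<ᵇ-false k b = det (<ᵇ-reflects-< (k + b) k) (ofⁿ (m+n≮m k b))

≡ᵇ-false : ∀ {a c} → a < c → (a ≡ᵇ c) ≡ false
≡ᵇ-false {a} {c} a<c = det (fromEquivalence (≡ᵇ⇒≡ a c) (≡⇒≡ᵇ a c)) (ofⁿ (<⇒≢ a<c))

≤ᵇ-suc : ∀ a b → (suc a ≤ᵇ suc b) ≡ (a ≤ᵇ b)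
≤ᵇ-suc zero    b = refl
≤ᵇ-suc (suc a) b = refl

+-≤ᵇ : ∀ k a b → (k + a ≤ᵇ k + b) ≡ (a ≤ᵇ b)
+-≤ᵇ zero    a b = refl
+-≤ᵇ (suc k) a b = trans (≤ᵇ-suc (k + a) (k + b)) (+-≤ᵇ k a b)

+-≡ᵇ : ∀ k a b → (k + a ≡ᵇ k + b) ≡ (a ≡ᵇ b)
+-≡ᵇ zero    a b = refl
+-≡ᵇ (suc k) a b = +-≡ᵇ k a b

incr-∷ : ∀ a t → incr t ≡ false → incr (a ∷ t) ≡ false
incr-∷ a (b ∷ t) eq = trans (cong ((a ≤ᵇ b) ∧_) eq) (∧-zeroʳ _)

incr-descent : ∀ {a b} t → b < a → incr (a ∷ b ∷ t) ≡ false
incr-descent t b<a = cong (_∧ incr (_ ∷ t)) (≤ᵇ-false b<a)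

incr-++ : ∀ {k} u v → All (_< k) u → All (k ≤_) v → incr (u ++ v) ≡ incr u ∧ incr v
incr-++ []          v       _              _             = refl
incr-++ (a ∷ [])    []      _              _             = refl
incr-++ (a ∷ [])    (c ∷ v) (a<k ∷ [])     (k≤c ∷ _)     =
  cong (_∧ incr (c ∷ v)) (det (≤ᵇ-reflects-≤ a c) (ofʸ (<⇒≤ (<-≤-trans a<k k≤c))))
incr-++ (a ∷ b ∷ u) v       (_ ∷ b∷u<k)    k≤v           =
  trans (cong ((a ≤ᵇ b) ∧_) (incr-++ (b ∷ u) v b∷u<k k≤v)) (sym (∧-assoc (a ≤ᵇ b) _ _))

incr-map-+ : ∀ k v → incr (map (k +_) v) ≡ incr v
incr-map-+ k []          = refl
incr-map-+ k (a ∷ [])    = refl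
incr-map-+ k (a ∷ b ∷ v) = cong₂ _∧_ (+-≤ᵇ k a b) (incr-map-+ k (b ∷ v))

All-+ : ∀ k v → All (k ≤_) (map (k +_) v)
All-+ k []      = []
All-+ k (b ∷ v) = m≤m+n k b ∷ All-+ k v

if-true≡not-∨ : ∀ e d → (if e then d else true) ≡ (not e ∨ d)
if-true≡not-∨ true  d = refl
if-true≡not-∨ false d = refl

-- Below k the conditions of Q̃ and F coincide; at the boundary no two letters are equal.
validQ-++ : ∀ {k} D p u v → All (_< k) u → All (k ≤_) v →
  validQ k D p (u ++ v) ≡ validF D p u ∧ validQ k D (p + length u) v
validQ-++ D p []          v       _            _         = cong (λ q → validQ _ D q v) (sym (+-identityʳ p))
validQ-++ D p (a ∷ [])    []      _            _         = refl
validQ-++ {k} D p (a ∷ []) (c ∷ v) (a<k ∷ []) (k≤c ∷ _)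
  rewrite ≡ᵇ-false (<-≤-trans a<k k≤c) = cong (λ q → validQ k D q (c ∷ v)) (+-comm 1 p)
validQ-++ D p (a ∷ b ∷ u) v       (a<k ∷ b∷u<k) k≤v
  rewrite <ᵇ-true a<k | validQ-++ D (suc p) (b ∷ u) v b∷u<k k≤v | if-true≡not-∨ (a ≡ᵇ b) (not (D p))
        | +-suc p (suc (length u)) = sym (∧-assoc (not (a ≡ᵇ b) ∨ not (D p)) _ _)

validQ-map-+ : ∀ k D p v → validQ k D p (map (k +_) v) ≡ validF (not ∘ D) p v
validQ-map-+ k D p []          = refl
validQ-map-+ k D p (a ∷ [])    = refl
validQ-map-+ k D p (a ∷ b ∷ v) = cong₂ _∧_ (primed-pair (D p)) (validQ-map-+ k D (suc p) (b ∷ v))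
  where
  primed-pair : ∀ d → (if k + a ≡ᵇ k + b then (if k + a <ᵇ k then not d else d) else true) ≡ (not (a ≡ᵇ b) ∨ not (not d))
  primed-pair d rewrite +-≡ᵇ k a b | +-<ᵇ-false k a | not-involutive d = if-true≡not-∨ (a ≡ᵇ b) d

validF-shift : ∀ E i p s → validF E (i + p) s ≡ validF (λ t → E (i + t)) p s
validF-shift E i p []          = refl
validF-shift E i p (a ∷ [])    = refl
validF-shift E i p (a ∷ b ∷ s) =
  cong ((not (a ≡ᵇ b) ∨ not (E (i + p))) ∧_)
       (trans (cong (λ q → validF E q (b ∷ s)) (sym (+-suc i p))) (validF-shift E i (suc p) (b ∷ s)))

validF-cong : ∀ s {E E′} → E ≗[ length s ∸ 1 ] E′ → validF E 1 s ≡ validF E′ 1 s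
validF-cong []          _    = refl
validF-cong (a ∷ [])    _    = refl
validF-cong (a ∷ b ∷ s) {E} {E′} E≗E′ = cong₂ (λ e rest → (not (a ≡ᵇ b) ∨ not e) ∧ rest) (E≗E′ 0 z<s) (begin
  validF E 2 (b ∷ s)         ≡⟨ validF-shift E 1 1 (b ∷ s) ⟩
  validF (E ∘ suc) 1 (b ∷ s)  ≡⟨ validF-cong (b ∷ s) (λ t t<s → E≗E′ (suc t) (s<s t<s)) ⟩
  validF (E′ ∘ suc) 1 (b ∷ s) ≡⟨ validF-shift E′ 1 1 (b ∷ s) ⟨
  validF E′ 2 (b ∷ s)        ∎)
  where open ≡-Reasoning

admissible-++ : ∀ {k} D u v → All (_< k) u →
  incr (u ++ map (k +_) v) ∧ validQ k D 1 (u ++ map (k +_) v)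
    ≡ (incr u ∧ validF D 1 u) ∧ (incr v ∧ validF (λ t → not (D (length u + t))) 1 v)
admissible-++ {k} D u v u<k = begin
  incr (u ++ v′) ∧ validQ k D 1 (u ++ v′)
    ≡⟨ cong₂ _∧_ (incr-++ u v′ u<k (All-+ k v)) (validQ-++ D 1 u v′ u<k (All-+ k v)) ⟩
  (incr u ∧ incr v′) ∧ (validF D 1 u ∧ validQ k D (1 + length u) v′)
    ≡⟨ cong₂ (λ b d → (incr u ∧ b) ∧ (validF D 1 u ∧ d)) (incr-map-+ k v) (validQ-map-+ k D _ v) ⟩
  (incr u ∧ incr v) ∧ (validF D 1 u ∧ validF (not ∘ D) (suc (length u)) v)
    ≡⟨ cong (λ q → (incr u ∧ incr v) ∧ (validF D 1 u ∧ validF (not ∘ D) q v)) (+-comm 1 (length u)) ⟩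
  (incr u ∧ incr v) ∧ (validF D 1 u ∧ validF (not ∘ D) (length u + 1) v)
    ≡⟨ cong (λ d → (incr u ∧ incr v) ∧ (validF D 1 u ∧ d)) (validF-shift (not ∘ D) (length u) 1 v) ⟩
  (incr u ∧ incr v) ∧ (validF D 1 u ∧ validF D′ 1 v)
    ≡⟨ ∧-interchange (incr u) (incr v) (validF D 1 u) (validF D′ 1 v) ⟩
  (incr u ∧ validF D 1 u) ∧ (incr v ∧ validF D′ 1 v) ∎
  where
  open ≡-Reasoning
  v′ = map (k +_) v
  D′ = λ t → not (D (length u + t))

module WordSums {c ℓ : Level} (R : CommutativeSemiring c ℓ) where
  open CommutativeSemiring R
    hiding (zero)
    renaming ( _+_ to _⊕_; +-cong to ⊕-cong; +-identityˡ to ⊕-identityˡ; +-identityʳ to ⊕-identityʳ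
             ; +-assoc to ⊕-assoc; +-comm to ⊕-comm; refl to ≈-refl; sym to ≈-sym; trans to ≈-trans)
  open CommutativeSemigroupProperties +-commutativeSemigroup using () renaming (interchange to ⊕-interchange)
  open Eval R
  open import Relation.Binary.Reasoning.Setoid setoid

  ∑ : ℕ → (ℕ → Carrier) → Carrier
  ∑ zero    f = 0#
  ∑ (suc m) f = f 0 ⊕ ∑ m (f ∘ suc)

  syntax ∑ m (λ a → e) = ∑[ a < m ] e

  ∑-cong : ∀ m {f g} → (∀ a → a < m → f a ≈ g a) → ∑ m f ≈ ∑ m g
  ∑-cong zero    _   = ≈-refl
  ∑-cong (suc m) f≈g = ⊕-cong (f≈g 0 z<s) (∑-cong m (λ a a<m → f≈g (suc a) (s<s a<m)))

  ∑-zero : ∀ m {f} → (∀ a → a < m → f a ≈ 0#) → ∑ m f ≈ 0#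
  ∑-zero zero    _    = ≈-refl
  ∑-zero (suc m) f≈0 = ≈-trans (⊕-cong (f≈0 0 z<s) (∑-zero m (λ a a<m → f≈0 (suc a) (s<s a<m)))) (⊕-identityˡ 0#)

  ∑-distrib-⊕ : ∀ m f g → ∑[ a < m ] (f a ⊕ g a) ≈ ∑ m f ⊕ ∑ m g
  ∑-distrib-⊕ zero    f g = ≈-sym (⊕-identityˡ 0#)
  ∑-distrib-⊕ (suc m) f g = ≈-trans (⊕-cong ≈-refl (∑-distrib-⊕ m _ _)) (⊕-interchange _ _ _ _)

  ∑-comm : ∀ m p (f : ℕ → ℕ → Carrier) → ∑[ a < m ] ∑[ i < p ] f a i ≈ ∑[ i < p ] ∑[ a < m ] f a i
  ∑-comm zero    p f = ≈-sym (∑-zero p (λ _ _ → ≈-refl))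
  ∑-comm (suc m) p f = ≈-trans (⊕-cong ≈-refl (∑-comm m p (f ∘ suc))) (≈-sym (∑-distrib-⊕ p _ _))

  ∑-+ : ∀ k l f → ∑ (k + l) f ≈ ∑ k f ⊕ ∑[ b < l ] f (k + b)
  ∑-+ zero    l f = ≈-sym (⊕-identityˡ _)
  ∑-+ (suc k) l f = ≈-trans (⊕-cong ≈-refl (∑-+ k l (f ∘ suc))) (≈-sym (⊕-assoc _ _ _))

  *-distribˡ-∑ : ∀ m f x → x * ∑ m f ≈ ∑[ a < m ] (x * f a)
  *-distribˡ-∑ zero    f x = zeroʳ x
  *-distribˡ-∑ (suc m) f x = ≈-trans (distribˡ x _ _) (⊕-cong ≈-refl (*-distribˡ-∑ m _ x))

  *-distribʳ-∑ : ∀ m f x → ∑ m f * x ≈ ∑[ a < m ] (f a * x)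
  *-distribʳ-∑ zero    f x = zeroˡ x
  *-distribʳ-∑ (suc m) f x = ≈-trans (distribʳ x _ _) (⊕-cong ≈-refl (*-distribʳ-∑ m _ x))

  sumR-applyUpTo : ∀ f m → sumR (applyUpTo f m) ≡ ∑ m f
  sumR-applyUpTo f zero    = refl
  sumR-applyUpTo f (suc m) = cong (f 0 ⊕_) (sumR-applyUpTo (f ∘ suc) m)

  sumR-upTo : ∀ f m → sumR (map f (upTo m)) ≡ ∑ m f
  sumR-upTo f m = trans (cong sumR (map-upTo f m)) (sumR-applyUpTo f m)

  sumR-++ : ∀ xs ys → sumR (xs ++ ys) ≈ sumR xs ⊕ sumR ys
  sumR-++ []       ys = ≈-sym (⊕-identityˡ _)
  sumR-++ (x ∷ xs) ys = ≈-trans (⊕-cong ≈-refl (sumR-++ xs ys)) (≈-sym (⊕-assoc _ _ _))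

  prodR-++ : ∀ xs ys → prodR (xs ++ ys) ≈ prodR xs * prodR ys
  prodR-++ []       ys = ≈-sym (*-identityˡ _)
  prodR-++ (x ∷ xs) ys = ≈-trans (*-cong ≈-refl (prodR-++ xs ys)) (≈-sym (*-assoc _ _ _))

  sumR-concatMap : ∀ {A B : Set} (h : B → Carrier) (G : A → List B) xs →
    sumR (map h (concatMap G xs)) ≈ sumR (map (λ a → sumR (map h (G a))) xs)
  sumR-concatMap h G []       = ≈-refl
  sumR-concatMap h G (x ∷ xs) = ≈-trans (reflexive (cong sumR (map-++ h (G x) (concatMap G xs))))
    (≈-trans (sumR-++ (map h (G x)) _) (⊕-cong ≈-refl (sumR-concatMap h G xs)))

  sumR-filterᵇ : ∀ {A : Set} (P : A → Bool) f xs →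
    sumR (map f (filterᵇ P xs)) ≈ sumR (map (λ s → if P s then f s else 0#) xs)
  sumR-filterᵇ P f []       = ≈-refl
  sumR-filterᵇ P f (x ∷ xs) with P x
  ... | true  = ⊕-cong ≈-refl (sumR-filterᵇ P f xs)
  ... | false = ≈-trans (sumR-filterᵇ P f xs) (≈-sym (⊕-identityˡ _))

  sumWords : ℕ → ℕ → (List ℕ → Carrier) → Carrier
  sumWords zero    m g = g []
  sumWords (suc n) m g = ∑[ a < m ] sumWords n m (λ s → g (a ∷ s))

  sumR-words : ∀ n m h → sumR (map h (words n m)) ≈ sumWords n m h
  sumR-words zero    m h = ⊕-identityʳ _
  sumR-words (suc n) m h = begin
    sumR (map h (concatMap (λ a → map (a ∷_) (words n m)) (upTo m)))
      ≈⟨ sumR-concatMap h _ (upTo m) ⟩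
    sumR (map (λ a → sumR (map h (map (a ∷_) (words n m)))) (upTo m))
      ≡⟨ sumR-upTo _ m ⟩
    ∑[ a < m ] sumR (map h (map (a ∷_) (words n m)))
      ≈⟨ ∑-cong m (λ a _ → ≈-trans (reflexive (cong sumR (sym (map-∘ (words n m))))) (sumR-words n m _)) ⟩
    ∑[ a < m ] sumWords n m (λ s → h (a ∷ s)) ∎

  sumWords-cong : ∀ n m {g h} → (∀ s → All (_< m) s → length s ≡ n → g s ≈ h s) → sumWords n m g ≈ sumWords n m h
  sumWords-cong zero    m g≈h = g≈h [] [] refl
  sumWords-cong (suc n) m g≈h =
    ∑-cong m (λ a a<m → sumWords-cong n m (λ s s<m len → g≈h (a ∷ s) (a<m ∷ s<m) (cong suc len)))

  sumWords-zero : ∀ n m {g} → (∀ s → g s ≈ 0#) → sumWords n m g ≈ 0#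
  sumWords-zero zero    m g≈0 = g≈0 []
  sumWords-zero (suc n) m g≈0 = ∑-zero m (λ a _ → sumWords-zero n m (λ s → g≈0 (a ∷ s)))

  *-distribˡ-sumWords : ∀ n m g x → x * sumWords n m g ≈ sumWords n m (λ s → x * g s)
  *-distribˡ-sumWords zero    m g x = ≈-refl
  *-distribˡ-sumWords (suc n) m g x =
    ≈-trans (*-distribˡ-∑ m _ x) (∑-cong m (λ a _ → *-distribˡ-sumWords n m _ x))

  sumWords-*-sumWords : ∀ i k j l f g →
    sumWords i k f * sumWords j l g ≈ sumWords i k (λ u → sumWords j l (λ v → f u * g v))
  sumWords-*-sumWords zero    k j l f g = *-distribˡ-sumWords j l g (f [])
  sumWords-*-sumWords (suc i) k j l f g =
    ≈-trans (*-distribʳ-∑ k _ _) (∑-cong k (λ a _ → sumWords-*-sumWords i k j l _ g))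

  weightF : (ℕ → Bool) → (ℕ → Carrier) → List ℕ → Carrier
  weightF E w s = if incr s ∧ validF E 1 s then prodR (map w s) else 0#

  weightQ : ℕ → (ℕ → Bool) → (ℕ → Carrier) → (ℕ → Carrier) → List ℕ → Carrier
  weightQ k D x y s = if incr s ∧ validQ k D 1 s then prodR (map (z k x y) s) else 0#

  F-sumWords : ∀ n E m w → F n E m w ≈ sumWords n m (weightF E w)
  F-sumWords n E m w = ≈-trans (sumR-filterᵇ _ _ (words n m)) (sumR-words n m _)

  Q-sumWords : ∀ n D k l x y → Q n D k l x y ≈ sumWords n (k + l) (weightQ k D x y)
  Q-sumWords n D k l x y = ≈-trans (sumR-filterᵇ _ _ (words n (k + l))) (sumR-words n (k + l) _)

  weightF-cong : ∀ i {E E′} w s → length s ≡ i → E ≗[ i ∸ 1 ] E′ → weightF E w s ≡ weightF E′ w s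
  weightF-cong i w s refl E≗E′ = cong (λ b → if incr s ∧ b then prodR (map w s) else 0#) (validF-cong s E≗E′)

  weightQ-nonincreasing : ∀ k D x y s → incr s ≡ false → weightQ k D x y s ≈ 0#
  weightQ-nonincreasing k D x y s eq =
    reflexive (cong (λ b → if b ∧ validQ k D 1 s then prodR (map (z k x y) s) else 0#) eq)

  if-∧-* : ∀ b₁ b₂ {p p₁ p₂} → p ≈ p₁ * p₂ →
    (if b₁ ∧ b₂ then p else 0#) ≈ (if b₁ then p₁ else 0#) * (if b₂ then p₂ else 0#)
  if-∧-* true  true  p≈ = p≈
  if-∧-* true  false _  = ≈-sym (zeroʳ _)
  if-∧-* false b₂    _  = ≈-sym (zeroˡ _)

  map-z-unprimed : ∀ k x y u → All (_< k) u → map (z k x y) u ≡ map x u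
  map-z-unprimed k x y []      []           = refl
  map-z-unprimed k x y (a ∷ u) (a<k ∷ u<k) rewrite <ᵇ-true a<k = cong (x a ∷_) (map-z-unprimed k x y u u<k)

  map-z-primed : ∀ k x y v → map (z k x y) (map (k +_) v) ≡ map y v
  map-z-primed k x y []      = refl
  map-z-primed k x y (b ∷ v) rewrite +-<ᵇ-false k b | m+n∸m≡n k b = cong (y b ∷_) (map-z-primed k x y v)

  weightQ-++ : ∀ k D x y i u v → All (_< k) u → length u ≡ i →
    weightQ k D x y (u ++ map (k +_) v) ≈ weightF D x u * weightF (λ t → not (D (i + t))) y v
  weightQ-++ k D x y i u v u<k refl = ≈-trans (reflexive (cong (λ b → if b then _ else 0#) (admissible-++ D u v u<k)))
                                             (if-∧-* (incr u ∧ validF D 1 u) (incr v ∧ validF D′ 1 v) product)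
    where
    v′ = map (k +_) v
    D′ = λ t → not (D (length u + t))
    product : prodR (map (z k x y) (u ++ v′)) ≈ prodR (map x u) * prodR (map y v)
    product = ≈-trans (reflexive (cong prodR (trans (map-++ (z k x y) u v′)
                                                     (cong₂ _++_ (map-z-unprimed k x y u u<k) (map-z-primed k x y v)))))
                      (prodR-++ (map x u) (map y v))

  -- Every increasing word over {0, …, k + l − 1} is uniquely u ++ map (k +_) v with u over {0, …, k − 1}.
  sumWords-+ : ∀ k l n g → (∀ s → incr s ≡ false → g s ≈ 0#) →
    sumWords n (k + l) g ≈ ∑[ i < suc n ] sumWords i k (λ u → sumWords (n ∸ i) l (λ v → g (u ++ map (k +_) v)))
  sumWords-+ k l zero    g _    = ≈-sym (⊕-identityʳ _)
  sumWords-+ k l (suc n) g g≈0 = begin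
    ∑[ a < k + l ] sumWords n (k + l) (λ s → g (a ∷ s))
      ≈⟨ ∑-+ k l _ ⟩
    ∑[ a < k ] sumWords n (k + l) (λ s → g (a ∷ s)) ⊕ ∑[ b < l ] sumWords n (k + l) (λ s → g (k + b ∷ s))
      ≈⟨ ⊕-cong (∑-cong k (λ a _ → sumWords-+ k l n _ (λ s → g≈0 (a ∷ s) ∘ incr-∷ a s)))
                (∑-cong l (λ b _ → primed-first b)) ⟩
    ∑[ a < k ] ∑[ i < suc n ] T a i ⊕ sumWords (suc n) l (λ v → g (map (k +_) v))
      ≈⟨ ⊕-cong (∑-comm k (suc n) T) ≈-refl ⟩
    ∑[ i < suc n ] ∑[ a < k ] T a i ⊕ sumWords (suc n) l (λ v → g (map (k +_) v))
      ≈⟨ ⊕-comm _ _ ⟩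
    ∑[ i < suc (suc n) ] sumWords i k (λ u → sumWords (suc n ∸ i) l (λ v → g (u ++ map (k +_) v))) ∎
    where
    T : ℕ → ℕ → Carrier
    T a i = sumWords i k (λ u → sumWords (n ∸ i) l (λ v → g (a ∷ u ++ map (k +_) v)))
    -- after a primed letter only primed letters may follow
    primed-first : ∀ b → sumWords n (k + l) (λ s → g (k + b ∷ s)) ≈ sumWords n l (λ v → g (k + b ∷ map (k +_) v))
    primed-first b = ≈-trans (sumWords-+ k l n _ (λ s → g≈0 (k + b ∷ s) ∘ incr-∷ (k + b) s))
      (≈-trans (⊕-cong ≈-refl (∑-zero n (λ i _ → ∑-zero k (λ a a<k → sumWords-zero i k (λ u →
                 sumWords-zero (n ∸ suc i) l (λ v →
                   g≈0 _ (incr-descent (u ++ map (k +_) v) (<-≤-trans a<k (m≤m+n k b)))))))))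
               (⊕-identityʳ _))

  Q-factorisation : ∀ k l n x y D (E₁ E₂ : ℕ → ℕ → Bool) →
    (∀ i → i ≤ n → E₁ i ≗[ i ∸ 1 ] D × E₂ i ≗[ n ∸ i ∸ 1 ] (λ t → not (D (i + t)))) →
    Q n D k l x y ≈ sumR (map (λ i → F i (E₁ i) k x * F (n ∸ i) (E₂ i) l y) (upTo (suc n)))
  Q-factorisation k l n x y D E₁ E₂ agree = begin
    Q n D k l x y
      ≈⟨ Q-sumWords n D k l x y ⟩
    sumWords n (k + l) (weightQ k D x y)
      ≈⟨ sumWords-+ k l n _ (weightQ-nonincreasing k D x y) ⟩
    ∑[ i < suc n ] sumWords i k (λ u → sumWords (n ∸ i) l (λ v → weightQ k D x y (u ++ map (k +_) v)))
      ≈⟨ ∑-cong (suc n) (λ i i<1+n → factor i (s≤s⁻¹ i<1+n)) ⟩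
    ∑[ i < suc n ] (F i (E₁ i) k x * F (n ∸ i) (E₂ i) l y)
      ≡⟨ sumR-upTo _ (suc n) ⟨
    sumR (map (λ i → F i (E₁ i) k x * F (n ∸ i) (E₂ i) l y) (upTo (suc n))) ∎
    where
    factor : ∀ i → i ≤ n →
      sumWords i k (λ u → sumWords (n ∸ i) l (λ v → weightQ k D x y (u ++ map (k +_) v)))
        ≈ F i (E₁ i) k x * F (n ∸ i) (E₂ i) l y
    factor i i≤n = let E₁≗D , E₂≗D′ = agree i i≤n in begin
      sumWords i k (λ u → sumWords (n ∸ i) l (λ v → weightQ k D x y (u ++ map (k +_) v)))
        ≈⟨ sumWords-cong i k (λ u u<k len → sumWords-cong (n ∸ i) l (λ v _ _ → weightQ-++ k D x y i u v u<k len)) ⟩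
      sumWords i k (λ u → sumWords (n ∸ i) l (λ v → weightF D x u * weightF (λ t → not (D (i + t))) y v))
        ≈⟨ sumWords-*-sumWords i k (n ∸ i) l _ _ ⟨
      sumWords i k (weightF D x) * sumWords (n ∸ i) l (weightF (λ t → not (D (i + t))) y)
        ≈⟨ *-cong (sumWords-cong i k (λ u _ len → reflexive (weightF-cong i x u len (sym ∘₂ E₁≗D))))
                  (sumWords-cong (n ∸ i) l (λ v _ len → reflexive (weightF-cong (n ∸ i) y v len (sym ∘₂ E₂≗D′)))) ⟩
      sumWords i k (weightF (E₁ i) x) * sumWords (n ∸ i) l (weightF (E₂ i) y)
        ≈⟨ *-cong (F-sumWords i (E₁ i) k x) (F-sumWords (n ∸ i) (E₂ i) l y) ⟨
      F i (E₁ i) k x * F (n ∸ i) (E₂ i) l y ∎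

theorem4p1 : {c ℓ : Level} (R : CommutativeSemiring c ℓ)
    → (k l n : ℕ) (x y : ℕ → CommutativeSemiring.Carrier R) (D : ℕ → Bool)
    → 1 ≤ n → D ⊆[ n ∸ 1 ]
    → (Σ[ D1 ∈ (ℕ → ℕ → Bool) ] Σ[ D2 ∈ (ℕ → ℕ → Bool) ]
          (∀ i → i ≤ n → Split n D i (D1 i) (D2 i)))
      × (∀ (D1 D2 : ℕ → ℕ → Bool)
          → (∀ i → i ≤ n → Split n D i (D1 i) (D2 i))
          → CommutativeSemiring._≈_ R (Eval.Q R n D k l x y)
              (Eval.sumR R (map (λ i → CommutativeSemiring._*_ R (Eval.F R i (D1 i) k x)
                                     (Eval.F R (n ∸ i) (D2 i) l y))
                                (upTo (suc n)))))
theorem4p1 R k l n x y D _ _ =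
    (D₁ D , D₂ n D , Split-D₁-D₂ n D)
  , λ E₁ E₂ split → WordSums.Q-factorisation R k l n x y D E₁ E₂
                      (λ i i≤n → Split-unique n D i i≤n (split i i≤n))
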